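{- Let $k \geq 2$ be an integer, let $(a_n)_{n \geq 0}$ be a $k$-automatic sequence with values in $\{0,1\}$, and let $A = \{ n \in \mathbb{N} : a_n = 1\}$. Then there is an algorithm which, given a deterministic finite automaton with output computing $(a_n)$, produces a linear representation (in base $k$) for each of the functions $R_1^{(A)}(n)$, $R_2^{(A)}(n)$, $R_3^{(A)}(n)$.
   Context: $\mathbb{N} = \{0,1,2,\ldots\}$. For $A \subseteq \mathbb{N}$ and $n \in \mathbb{N}$: $R_1^{(A)}(n) = |\{(x,y) \in \mathbb{N}^2 : x,y \in A,\ x+y=n\}|$; $R_2^{(A)}(n) = |\{(x,y) \in \mathbb{N}^2 : x,y \in A,\ x+y=n,\ x<y\}|$; $R_3^{(A)}(n) = |\{(x,y) \in \mathbb{N}^2 : x,y \in A,\ x+y=n,\ x\le y\}|$. A sequence $(a_n)$ is $k$-automatic if there is a deterministic finite automaton with output (DFAO) which, when fed the base-$k$ digits of $n$ (most significant digit first), ends in a state whose output is $a_n$. A function $f:\mathbb{N}\to\mathbb{Q}$ has a linear representation of rank $r$ in base $k$ if there are a row vector $u \in \mathbb{Q}^{1\times r}$, a column vector $v \in \mathbb{Q}^{r\times 1}$, and a monoid morphism $\gamma$ from the free monoid on $\{0,1,\ldots,k-1\}$ to $r\times r$ rational matrices such that $f(n) = u\,\gamma(x)\,v$ for every base-$k$ representation $x$ of $n$ (including those with leading zeros). -}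

module Defs where

open import Data.Nat using (ℕ; zero; suc; _+_; _*_; _≡ᵇ_; _<ᵇ_; _≤ᵇ_)
open import Data.Bool using (Bool; true; false; _∧_; if_then_else_)
open import Data.Fin using (Fin; toℕ)
import Data.Fin as Fin
open import Data.List using (List; []; _∷_; foldl; upTo)
open import Data.Product using (Σ; Σ-syntax; _×_)
open import Data.Unit using (⊤)
open import Data.Integer using (+_)
open import Data.Rational using (ℚ; 0ℚ; 1ℚ; _/_) renaming (_+_ to _+ℚ_; _*_ to _*ℚ_)
open import Relation.Binary.PropositionalEquality using (_≡_; _≢_)

-- Words over the base-k digit alphabet {0,…,k-1}, most significant digit first.
Word : ℕ → Set
Word k = List (Fin k)

value : (k : ℕ) → Word k → ℕ
value k = foldl (λ acc d → acc * k + toℕ d) 0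

-- A word has no leading zero (the empty word counts; it is the canonical
-- representation of 0).
NoLeadingZero : {k : ℕ} → Word k → Set
NoLeadingZero []      = ⊤
NoLeadingZero (d ∷ _) = toℕ d ≢ 0

record DFAO (k : ℕ) : Set where
  field
    nStates : ℕ
    start   : Fin nStates
    δ       : Fin nStates → Fin k → Fin nStates
    τ       : Fin nStates → Bool

run : {k : ℕ} (M : DFAO k) → Fin (DFAO.nStates M) → Word k → Fin (DFAO.nStates M)
run M q []       = q
run M q (d ∷ w)  = run M (DFAO.δ M q d) w

Computes : {k : ℕ} → DFAO k → (ℕ → Bool) → Set
Computes {k} M a = (w : Word k) → NoLeadingZero w →
  a (value k w) ≡ DFAO.τ M (run M (DFAO.start M) w)

sumℕ : ℕ → (ℕ → ℕ) → ℕ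
sumℕ zero    f = 0
sumℕ (suc n) f = sumℕ n f + f n

ind : Bool → ℕ
ind true  = 1
ind false = 0

-- A = {n : a n = true}. Pairs (x,y) ∈ ℕ² with x + y = n necessarily have x,y ≤ n.
R₁ R₂ R₃ : (ℕ → Bool) → ℕ → ℕ
R₁ a n = sumℕ (suc n) λ x → sumℕ (suc n) λ y →
  ind (a x ∧ a y ∧ (x + y ≡ᵇ n))
R₂ a n = sumℕ (suc n) λ x → sumℕ (suc n) λ y →
  ind (a x ∧ a y ∧ (x + y ≡ᵇ n) ∧ (x <ᵇ y))
R₃ a n = sumℕ (suc n) λ x → sumℕ (suc n) λ y →
  ind (a x ∧ a y ∧ (x + y ≡ᵇ n) ∧ (x ≤ᵇ y))

Mat : ℕ → Set
Mat r = Fin r → Fin r → ℚ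

sumℚ : (r : ℕ) → (Fin r → ℚ) → ℚ
sumℚ zero    f = 0ℚ
sumℚ (suc r) f = f Fin.zero +ℚ sumℚ r (λ i → f (Fin.suc i))

matMul : {r : ℕ} → Mat r → Mat r → Mat r
matMul {r} P Q i j = sumℚ r (λ l → P i l *ℚ Q l j)

identity : {r : ℕ} → Mat r
identity i j with toℕ i ≡ᵇ toℕ j
... | true  = 1ℚ
... | false = 0ℚ

γ* : {k r : ℕ} → (Fin k → Mat r) → Word k → Mat r
γ* γ []      = identity
γ* γ (d ∷ w) = matMul (γ d) (γ* γ w)

record LinRep (k : ℕ) : Set where
  field
    rank : ℕ
    u    : Fin rank → ℚ
    γ    : Fin k → Mat rank
    v    : Fin rank → ℚ

evalRep : {k : ℕ} (ρ : LinRep k) → Word k → ℚ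
evalRep ρ x = sumℚ rank λ i → sumℚ rank λ j → u i *ℚ (γ* γ x i j *ℚ v j)
  where open LinRep ρ

toℚ : ℕ → ℚ
toℚ n = + n / 1

Represents : {k : ℕ} → LinRep k → (ℕ → ℕ) → Set
Represents {k} ρ f = (x : Word k) → toℚ (f (value k x)) ≡ evalRep ρ x

-- Guess the base-k digits of x and y together with those of n = x + y, most significant digit
-- first.  A guess is summarised by a state (p , q , c , o): the states reached by the automaton on
-- the digits of x and of y read so far, the carry that the remaining lower digits must produce,
-- and the lexicographic comparison of x and y so far.  On reading the digit d of n, the digits
-- x′, y′ are admissible exactly when x′ + y′ + (carry from the lower digits) = d + k · c, which
-- fixes the carry demanded from the lower digits.  The accepting runs on a representation w of n
-- therefore correspond to the pairs counted by R₁, R₂ or R₃ (depending on which comparisons are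
-- accepted), and the number of accepting runs of a finite automaton with multiplicities is
-- u γ(w) v, where γ(d) is its matrix of transition counts.  Leading zeros are absorbed by a copy
-- of the start state, because M is only assumed to read canonical representations.
module Submission where

open import Algebra.Bundles using (Semiring; CommutativeRing)
import Algebra.Properties.Semiring.Sum as SemiringSum
open import Data.Bool using (Bool; true; false; if_then_else_; _∧_; not)
open import Data.Bool.Properties using (∧-zeroʳ; ∧-identityʳ)
open import Data.Fin using (Fin; zero; suc; toℕ)
open import Data.Fin.Properties using (toℕ<n; *↔×; 2↔Bool)
import Data.Integer as ℤ
import Data.Integer.Properties as ℤ
open import Data.List using ([]; _∷_; foldl; length)
open import Data.Maybe using (Maybe; just; nothing; maybe′)
import Data.Maybe as Maybe
open import Data.Nat using (ℕ; zero; suc; _≡ᵇ_)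
import Data.Nat.Coprimality as Coprimality
import Data.Nat.Properties as ℕ
open import Data.Product using (Σ-syntax; _×_; _,_)
open import Data.Product.Function.NonDependent.Propositional using (_×-↔_)
open import Data.Rational using (ℚ; mkℚ; _/_)
import Data.Rational as ℚ
import Data.Rational.Properties as ℚ
open import Data.Unit using (tt)
open import Data.Vec.Functional using (Vector; replicate)
open import Function using (_∘_)
open import Function.Bundles using (_↔_; Inverse; mk↔ₛ′; mk⇔)
open import Function.Properties.Inverse using (↔-refl; ↔-trans)
open import Level using (0ℓ)
open import Relation.Binary.Definitions using (tri<; tri≈; tri>)
open import Relation.Binary.PropositionalEquality
  using (_≡_; _≢_; refl; sym; trans; cong; cong₂; module ≡-Reasoning)
open import Relation.Nullary using (yes; no)
open import Relation.Nullary.Decidable using (does-⇔; dec-false)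

open import Defs

module Sums {c ℓ} (R : Semiring c ℓ) where
  open Semiring R
    using (Carrier; _≈_; _+_; _*_; 0#; 1#; +-cong; +-identityˡ; +-identityʳ; *-identityˡ; zeroˡ; setoid)
  open SemiringSum R
  open import Relation.Binary.Reasoning.Setoid setoid

  kronecker : ∀ {n} → Fin n → Fin n → Carrier
  kronecker i j = if toℕ i ≡ᵇ toℕ j then 1# else 0#

  sum-zero : ∀ {n} (f : Vector Carrier n) → (∀ i → f i ≈ 0#) → sum f ≈ 0#
  sum-zero {n} f f≈0 = begin
    sum f                 ≈⟨ sum-cong-≋ f≈0 ⟩
    sum (replicate n 0#)  ≈⟨ sum-replicate-zero n ⟩
    0#                    ∎

  sum-kronecker : ∀ {n} (i : Fin n) (f : Vector Carrier n) → ∑[ j < n ] (kronecker i j * f j) ≈ f i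
  sum-kronecker {suc n} zero f = begin
    1# * f zero + ∑[ j < n ] (0# * f (suc j))
      ≈⟨ +-cong (*-identityˡ (f zero)) (sum-zero _ (λ j → zeroˡ (f (suc j)))) ⟩
    f zero + 0#
      ≈⟨ +-identityʳ (f zero) ⟩
    f zero
      ∎
  sum-kronecker {suc n} (suc i) f = begin
    0# * f zero + ∑[ j < n ] (kronecker i j * f (suc j))
      ≈⟨ +-cong (zeroˡ (f zero)) (sum-kronecker i (f ∘ suc)) ⟩
    0# + f (suc i)
      ≈⟨ +-identityˡ (f (suc i)) ⟩
    f (suc i)
      ∎

open import Data.Nat using (_+_; _*_; _^_; _∸_; _<_; _≤_; _<ᵇ_; _≤ᵇ_; z≤n; s≤s)
open import Data.Nat.Tactic.RingSolver using (solve-∀)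

open SemiringSum ℕ.+-*-semiring using (sum; sum-syntax; sum-cong-≗; ∑-comm; *-distribʳ-sum)
open Sums ℕ.+-*-semiring using (kronecker; sum-kronecker; sum-zero)

ℚ-semiring : Semiring 0ℓ 0ℓ
ℚ-semiring = CommutativeRing.semiring ℚ.+-*-commutativeRing

module Σℚ = SemiringSum ℚ-semiring
module Kℚ = Sums ℚ-semiring

sumℚ≡sum : ∀ r (f : Vector ℚ r) → sumℚ r f ≡ Σℚ.sum f
sumℚ≡sum zero    f = refl
sumℚ≡sum (suc r) f = cong (f zero ℚ.+_) (sumℚ≡sum r (f ∘ suc))

toℚ≡mkℚ : ∀ m → toℚ m ≡ mkℚ (ℤ.+ m) 0 (Coprimality.sym (Coprimality.1-coprimeTo m))
toℚ≡mkℚ m = ℚ.normalize-coprime (Coprimality.sym (Coprimality.1-coprimeTo m))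

toℚ-+ : ∀ m n → toℚ (m + n) ≡ toℚ m ℚ.+ toℚ n
toℚ-+ m n = trans (cong (_/ 1) (sym numerator)) (sym (cong₂ ℚ._+_ (toℚ≡mkℚ m) (toℚ≡mkℚ n)))
  where
  numerator : ℤ.+ m ℤ.* ℤ.+ 1 ℤ.+ ℤ.+ n ℤ.* ℤ.+ 1 ≡ ℤ.+ (m + n)
  numerator = trans (cong₂ ℤ._+_ (ℤ.*-identityʳ (ℤ.+ m)) (ℤ.*-identityʳ (ℤ.+ n)))
                    (sym (ℤ.pos-+ m n))

toℚ-* : ∀ m n → toℚ (m * n) ≡ toℚ m ℚ.* toℚ n
toℚ-* m n = trans (cong (_/ 1) (ℤ.pos-* m n)) (sym (cong₂ ℚ._*_ (toℚ≡mkℚ m) (toℚ≡mkℚ n)))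

toℚ-sum : ∀ {n} (f : Vector ℕ n) → toℚ (sum f) ≡ Σℚ.sum (toℚ ∘ f)
toℚ-sum {zero}  f = refl
toℚ-sum {suc n} f =
  trans (toℚ-+ (f zero) (sum (f ∘ suc))) (cong (toℚ (f zero) ℚ.+_) (toℚ-sum (f ∘ suc)))

infixr 7 _·_

_·_ : ∀ {r} → Mat r → Vector ℚ r → Vector ℚ r
(P · v) i = Σℚ.sum (λ j → P i j ℚ.* v j)

·-congʳ : ∀ {r} (P : Mat r) {v v′ : Vector ℚ r} → (∀ j → v j ≡ v′ j) →
          ∀ i → (P · v) i ≡ (P · v′) i
·-congʳ P v≗v′ i = Σℚ.sum-cong-≗ (λ j → cong (P i j ℚ.*_) (v≗v′ j))

identity-· : ∀ {r} (v : Vector ℚ r) i → (identity · v) i ≡ v i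
identity-· v i =
  trans (Σℚ.sum-cong-≗ (λ j → cong (ℚ._* v j) (identity≡kronecker i j))) (Kℚ.sum-kronecker i v)
  where
  identity≡kronecker : ∀ {r} (i j : Fin r) → identity i j ≡ Kℚ.kronecker i j
  identity≡kronecker i j with toℕ i ≡ᵇ toℕ j
  ... | true  = refl
  ... | false = refl

matMul-· : ∀ {r} (P Q : Mat r) v i → (matMul P Q · v) i ≡ (P · (Q · v)) i
matMul-· {r} P Q v i = begin
  Σℚ.sum (λ j → sumℚ r (λ l → P i l ℚ.* Q l j) ℚ.* v j)
    ≡⟨ Σℚ.sum-cong-≗ (λ j → trans (cong (ℚ._* v j) (sumℚ≡sum r (λ l → P i l ℚ.* Q l j)))
                                  (Σℚ.*-distribʳ-sum (v j) (λ l → P i l ℚ.* Q l j))) ⟩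
  Σℚ.sum (λ j → Σℚ.sum (λ l → (P i l ℚ.* Q l j) ℚ.* v j))
    ≡⟨ Σℚ.∑-comm (λ j l → (P i l ℚ.* Q l j) ℚ.* v j) ⟩
  Σℚ.sum (λ l → Σℚ.sum (λ j → (P i l ℚ.* Q l j) ℚ.* v j))
    ≡⟨ Σℚ.sum-cong-≗ (λ l → trans (Σℚ.sum-cong-≗ (λ j → ℚ.*-assoc (P i l) (Q l j) (v j)))
                                  (sym (Σℚ.*-distribˡ-sum (P i l) (λ j → Q l j ℚ.* v j)))) ⟩
  Σℚ.sum (λ l → P i l ℚ.* Σℚ.sum (λ j → Q l j ℚ.* v j))
    ∎
  where open ≡-Reasoning

evalRep-· : ∀ {k} (ρ : LinRep k) x →
  let open LinRep ρ in evalRep ρ x ≡ Σℚ.sum (λ i → u i ℚ.* (γ* γ x · v) i)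
evalRep-· ρ x = trans (sumℚ≡sum rank _) (Σℚ.sum-cong-≗ (λ i → begin
  sumℚ rank (λ j → u i ℚ.* (γ* γ x i j ℚ.* v j))
    ≡⟨ sumℚ≡sum rank _ ⟩
  Σℚ.sum (λ j → u i ℚ.* (γ* γ x i j ℚ.* v j))
    ≡⟨ Σℚ.*-distribˡ-sum (u i) (λ j → γ* γ x i j ℚ.* v j) ⟨
  u i ℚ.* (γ* γ x · v) i
    ∎))
  where
  open LinRep ρ
  open ≡-Reasoning

module WeightedAutomaton {k r : ℕ} (T : Fin k → Fin r → Fin r → ℕ) (F : Fin r → ℕ) where

  paths : Fin r → Word k → ℕ
  paths i []      = F i
  paths i (d ∷ w) = ∑[ j < r ] (T d i j * paths j w)

  γᵀ : Fin k → Mat r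
  γᵀ d i j = toℚ (T d i j)

  linRep : Fin r → LinRep k
  linRep i₀ = record { rank = r ; u = identity i₀ ; γ = γᵀ ; v = toℚ ∘ F }

  γ*-paths : ∀ w i → (γ* γᵀ w · toℚ ∘ F) i ≡ toℚ (paths i w)
  γ*-paths []      i = identity-· (toℚ ∘ F) i
  γ*-paths (d ∷ w) i = begin
    (matMul (γᵀ d) (γ* γᵀ w) · toℚ ∘ F) i
      ≡⟨ matMul-· (γᵀ d) (γ* γᵀ w) (toℚ ∘ F) i ⟩
    (γᵀ d · γ* γᵀ w · toℚ ∘ F) i
      ≡⟨ ·-congʳ (γᵀ d) (γ*-paths w) i ⟩
    Σℚ.sum (λ j → toℚ (T d i j) ℚ.* toℚ (paths j w))
      ≡⟨ Σℚ.sum-cong-≗ (λ j → toℚ-* (T d i j) (paths j w)) ⟨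
    Σℚ.sum (λ j → toℚ (T d i j * paths j w))
      ≡⟨ toℚ-sum (λ j → T d i j * paths j w) ⟨
    toℚ (paths i (d ∷ w))
      ∎
    where open ≡-Reasoning

  evalRep-linRep : ∀ i₀ w → evalRep (linRep i₀) w ≡ toℚ (paths i₀ w)
  evalRep-linRep i₀ w =
    trans (evalRep-· (linRep i₀) w)
          (trans (identity-· (γ* γᵀ w · toℚ ∘ F) i₀) (γ*-paths w i₀))

module FiniteAutomaton {k m r : ℕ} {S : Set} (states : Fin r ↔ S)
    (step : S → Fin k → Fin m → Fin m → Maybe S) (accept : S → ℕ) where
  open Inverse states using (to; from; strictlyInverseˡ)

  count : S → Word k → ℕ
  count s []      = accept s
  count s (d ∷ w) = ∑[ a < m ] ∑[ b < m ] maybe′ (λ s′ → count s′ w) 0 (step s d a b)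

  hits : Maybe S → Fin r → ℕ
  hits ms j = maybe′ (λ s′ → kronecker (from s′) j) 0 ms

  transitions : Fin k → Fin r → Fin r → ℕ
  transitions d i j = ∑[ a < m ] ∑[ b < m ] hits (step (to i) d a b) j

  open WeightedAutomaton transitions (accept ∘ to) using (paths; linRep; evalRep-linRep)

  count-to-from : ∀ s w → count (to (from s)) w ≡ count s w
  count-to-from s w = cong (λ s → count s w) (strictlyInverseˡ s)

  sum-hits : ∀ w ms → ∑[ j < r ] (hits ms j * count (to j) w) ≡ maybe′ (λ s′ → count s′ w) 0 ms
  sum-hits w nothing   = sum-zero (λ j → 0 * count (to j) w) (λ _ → refl)
  sum-hits w (just s′) = trans (sum-kronecker (from s′) (λ j → count (to j) w)) (count-to-from s′ w)

  paths≡count : ∀ w i → paths i w ≡ count (to i) w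
  paths≡count []      i = refl
  paths≡count (d ∷ w) i = begin
    ∑[ j < r ] ((∑[ a < m ] ∑[ b < m ] H a b j) * paths j w)
      ≡⟨ sum-cong-≗ (λ j → trans (cong (transitions d i j *_) (paths≡count w j)) (distrib j)) ⟩
    ∑[ j < r ] ∑[ a < m ] ∑[ b < m ] (H a b j * C j)
      ≡⟨ ∑-comm (λ j a → ∑[ b < m ] (H a b j * C j)) ⟩
    ∑[ a < m ] ∑[ j < r ] ∑[ b < m ] (H a b j * C j)
      ≡⟨ sum-cong-≗ (λ a → ∑-comm (λ j b → H a b j * C j)) ⟩
    ∑[ a < m ] ∑[ b < m ] ∑[ j < r ] (H a b j * C j)
      ≡⟨ sum-cong-≗ (λ a → sum-cong-≗ (λ b → sum-hits w (step (to i) d a b))) ⟩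
    count (to i) (d ∷ w)
      ∎
    where
    open ≡-Reasoning
    H : Fin m → Fin m → Fin r → ℕ
    H a b = hits (step (to i) d a b)
    C : Fin r → ℕ
    C j = count (to j) w
    distrib : ∀ j → (∑[ a < m ] ∑[ b < m ] H a b j) * C j ≡ ∑[ a < m ] ∑[ b < m ] (H a b j * C j)
    distrib j = trans (*-distribʳ-sum (C j) (λ a → ∑[ b < m ] H a b j))
                      (sum-cong-≗ (λ a → *-distribʳ-sum (C j) (λ b → H a b j)))

  countRep : S → LinRep k
  countRep s = linRep (from s)

  evalRep-countRep : ∀ s w → evalRep (countRep s) w ≡ toℚ (count s w)
  evalRep-countRep s w =
    trans (evalRep-linRep (from s) w) (cong toℚ (trans (paths≡count w (from s)) (count-to-from s w)))

sumℕ-cong : ∀ n {f g : ℕ → ℕ} → (∀ x → f x ≡ g x) → sumℕ n f ≡ sumℕ n g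
sumℕ-cong zero    f≗g = refl
sumℕ-cong (suc n) f≗g = cong₂ _+_ (sumℕ-cong n f≗g) (f≗g n)

sumℕ-zero : ∀ n (f : ℕ → ℕ) → (∀ x → f x ≡ 0) → sumℕ n f ≡ 0
sumℕ-zero zero    f f≗0 = refl
sumℕ-zero (suc n) f f≗0 = cong₂ _+_ (sumℕ-zero n f f≗0) (f≗0 n)

sumℕ-+ : ∀ m n (f : ℕ → ℕ) → sumℕ (m + n) f ≡ sumℕ m f + sumℕ n (λ x → f (m + x))
sumℕ-+ m zero    f =
  trans (cong (λ l → sumℕ l f) (ℕ.+-identityʳ m)) (sym (ℕ.+-identityʳ (sumℕ m f)))
sumℕ-+ m (suc n) f = begin
  sumℕ (m + suc n) f                                 ≡⟨ cong (λ l → sumℕ l f) (ℕ.+-suc m n) ⟩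
  sumℕ (m + n) f + f (m + n)                         ≡⟨ cong (_+ f (m + n)) (sumℕ-+ m n f) ⟩
  sumℕ m f + sumℕ n (λ x → f (m + x)) + f (m + n)    ≡⟨ ℕ.+-assoc (sumℕ m f) _ (f (m + n)) ⟩
  sumℕ m f + (sumℕ n (λ x → f (m + x)) + f (m + n))  ∎
  where open ≡-Reasoning

sumℕ-truncate : ∀ {n K} (f : ℕ → ℕ) → n < K → (∀ x → n < x → f x ≡ 0) →
  sumℕ K f ≡ sumℕ (suc n) f
sumℕ-truncate {n} {K} f n<K f≗0 = begin
  sumℕ K f                             ≡⟨ cong (λ l → sumℕ l f) (ℕ.m+[n∸m]≡n n<K) ⟨
  sumℕ (suc n + (K ∸ suc n)) f         ≡⟨ sumℕ-+ (suc n) (K ∸ suc n) f ⟩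
  sumℕ (suc n) f + sumℕ (K ∸ suc n) g  ≡⟨ cong (sumℕ (suc n) f +_) tail≡0 ⟩
  sumℕ (suc n) f + 0                   ≡⟨ ℕ.+-identityʳ (sumℕ (suc n) f) ⟩
  sumℕ (suc n) f                       ∎
  where
  open ≡-Reasoning
  g : ℕ → ℕ
  g x = f (suc n + x)
  tail≡0 : sumℕ (K ∸ suc n) g ≡ 0
  tail≡0 = sumℕ-zero (K ∸ suc n) g (λ x → f≗0 (suc n + x) (s≤s (ℕ.m≤m+n n x)))

sumℕ²-truncate : ∀ {n K} (g : ℕ → ℕ → ℕ) → n < K → (∀ x y → n < x + y → g x y ≡ 0) →
  sumℕ K (λ x → sumℕ K (g x)) ≡ sumℕ (suc n) (λ x → sumℕ (suc n) (g x))
sumℕ²-truncate {n} {K} g n<K g≗0 = trans (sumℕ-cong K inner) outer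
  where
  inner : ∀ x → sumℕ K (g x) ≡ sumℕ (suc n) (g x)
  inner x = sumℕ-truncate (g x) n<K (λ y n<y → g≗0 x y (ℕ.<-≤-trans n<y (ℕ.m≤n+m y x)))
  outer : sumℕ K (λ x → sumℕ (suc n) (g x)) ≡ sumℕ (suc n) (λ x → sumℕ (suc n) (g x))
  outer = sumℕ-truncate _ n<K (λ x n<x →
    sumℕ-zero (suc n) (g x) (λ y → g≗0 x y (ℕ.<-≤-trans n<x (ℕ.m≤m+n x y))))

sumℕ-* : ∀ m K (f : ℕ → ℕ) →
  ∑[ d < m ] sumℕ K (λ x → f (toℕ d * K + x)) ≡ sumℕ (m * K) f
sumℕ-* zero    K f = refl
sumℕ-* (suc m) K f = begin
  sumℕ K f + ∑[ d < m ] sumℕ K (λ x → f (K + toℕ d * K + x))  ≡⟨ cong (sumℕ K f +_) shifted ⟩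
  sumℕ K f + sumℕ (m * K) (λ x → f (K + x))                   ≡⟨ sumℕ-+ K (m * K) f ⟨
  sumℕ (K + m * K) f                                          ∎
  where
  open ≡-Reasoning
  shifted : ∑[ d < m ] sumℕ K (λ x → f (K + toℕ d * K + x)) ≡ sumℕ (m * K) (λ x → f (K + x))
  shifted = trans (sum-cong-≗ {m} (λ d → sumℕ-cong K (λ x → cong f (ℕ.+-assoc K (toℕ d * K) x))))
                  (sumℕ-* m K (λ x → f (K + x)))

<-positional : ∀ K {a b} x y → a < b → x < K → a * K + x < b * K + y
<-positional K {a} {b} x y a<b x<K = begin-strict
  a * K + x  <⟨ ℕ.+-monoʳ-< (a * K) x<K ⟩
  a * K + K  ≡⟨ ℕ.+-comm (a * K) K ⟩
  suc a * K  ≤⟨ ℕ.*-monoˡ-≤ K a<b ⟩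
  b * K      ≤⟨ ℕ.m≤m+n (b * K) y ⟩
  b * K + y  ∎
  where open ℕ.≤-Reasoning

data Comparison : Set where
  less equal greater : Comparison

3↔Comparison : Fin 3 ↔ Comparison
3↔Comparison = mk↔ₛ′ to from to∘from from∘to
  where
  to : Fin 3 → Comparison
  to zero             = less
  to (suc zero)       = equal
  to (suc (suc zero)) = greater
  from : Comparison → Fin 3
  from less    = zero
  from equal   = suc zero
  from greater = suc (suc zero)
  to∘from : ∀ o → to (from o) ≡ o
  to∘from less    = refl
  to∘from equal   = refl
  to∘from greater = refl
  from∘to : ∀ i → from (to i) ≡ i
  from∘to zero             = refl
  from∘to (suc zero)       = refl
  from∘to (suc (suc zero)) = refl

lex : Comparison → Comparison → Comparison
lex less    _ = less
lex equal   o = o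
lex greater _ = greater

lex-equalʳ : ∀ o → lex o equal ≡ o
lex-equalʳ less    = refl
lex-equalʳ equal   = refl
lex-equalʳ greater = refl

lex-assoc : ∀ o o′ o″ → lex (lex o o′) o″ ≡ lex o (lex o′ o″)
lex-assoc less    _ _ = refl
lex-assoc equal   _ _ = refl
lex-assoc greater _ _ = refl

cmp : ℕ → ℕ → Comparison
cmp zero    zero    = equal
cmp zero    (suc _) = less
cmp (suc _) zero    = greater
cmp (suc x) (suc y) = cmp x y

cmp-< : ∀ {x y} → x < y → cmp x y ≡ less
cmp-< {zero}  {suc y} _         = refl
cmp-< {suc x} {suc y} (s≤s x<y) = cmp-< x<y

cmp-> : ∀ {x y} → y < x → cmp x y ≡ greater
cmp-> {suc x} {zero}  _         = refl
cmp-> {suc x} {suc y} (s≤s y<x) = cmp-> y<x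

cmp-refl : ∀ x → cmp x x ≡ equal
cmp-refl zero    = refl
cmp-refl (suc x) = cmp-refl x

cmp-+ˡ : ∀ z x y → cmp (z + x) (z + y) ≡ cmp x y
cmp-+ˡ zero    x y = refl
cmp-+ˡ (suc z) x y = cmp-+ˡ z x y

cmp-positional : ∀ K a b {x y} → x < K → y < K → cmp (a * K + x) (b * K + y) ≡ lex (cmp a b) (cmp x y)
cmp-positional K a b {x} {y} x<K y<K with ℕ.<-cmp a b
... | tri< a<b _ _ rewrite cmp-< a<b  = cmp-< (<-positional K x y a<b x<K)
... | tri≈ _ refl _ rewrite cmp-refl a = cmp-+ˡ (a * K) x y
... | tri> _ _ b<a rewrite cmp-> b<a  = cmp-> (<-positional K y x b<a y<K)

isLess isAtMost : Comparison → Bool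
isLess less = true
isLess _    = false
isAtMost greater = false
isAtMost _       = true

isLess-cmp : ∀ x y → isLess (cmp x y) ≡ (x <ᵇ y)
isLess-cmp zero    zero    = refl
isLess-cmp zero    (suc y) = refl
isLess-cmp (suc x) zero    = refl
isLess-cmp (suc x) (suc y) = isLess-cmp x y

isAtMost-cmp : ∀ x y → isAtMost (cmp x y) ≡ (x ≤ᵇ y)
isAtMost-cmp zero    zero    = refl
isAtMost-cmp zero    (suc y) = refl
isAtMost-cmp (suc x) zero    = refl
isAtMost-cmp (suc x) (suc y) = trans (isAtMost-cmp x y) (sym (<ᵇ-suc x y))
  where
  <ᵇ-suc : ∀ x y → (x <ᵇ suc y) ≡ (x ≤ᵇ y)
  <ᵇ-suc zero    y = refl
  <ᵇ-suc (suc x) y = refl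

-- If the digits at some position add up to s and t is the digit of the sum plus k times the carry
-- owed to the next position, the lower positions must deliver the carry t ∸ s, which is 0 or 1.
carryIn : ℕ → ℕ → Maybe Bool
carryIn s t with t ℕ.≟ s
... | yes _ = just false
... | no  _ with t ℕ.≟ suc s
...   | yes _ = just true
...   | no  _ = nothing

≡ᵇ-positional : ∀ K s t {X n} → X < K + K → n < K →
  (s * K + X ≡ᵇ t * K + n) ≡ maybe′ (λ c → X ≡ᵇ n + ind c * K) false (carryIn s t)
≡ᵇ-positional K s t {X} {n} X<2K n<K with t ℕ.≟ s
... | yes refl = does-⇔ (mk⇔ (λ e → trans (ℕ.+-cancelˡ-≡ (s * K) X n e) (sym (ℕ.+-identityʳ n)))
                            (λ e → cong (s * K +_) (trans e (ℕ.+-identityʳ n))))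
                        (s * K + X ℕ.≟ s * K + n) (X ℕ.≟ n + 0)
... | no t≢s with t ℕ.≟ suc s
...   | yes refl = does-⇔ (mk⇔ (λ e → ℕ.+-cancelˡ-≡ (s * K) X (n + 1 * K) (trans e (carry s K n)))
                              (λ e → trans (cong (s * K +_) e) (sym (carry s K n))))
                          (s * K + X ℕ.≟ suc s * K + n) (X ℕ.≟ n + 1 * K)
  where
  carry : ∀ s K n → suc s * K + n ≡ s * K + (n + 1 * K)
  carry = solve-∀
...   | no t≢1+s = dec-false (s * K + X ℕ.≟ t * K + n) impossible
  where
  impossible : s * K + X ≢ t * K + n
  impossible e with ℕ.<-cmp t s
  ... | tri< t<s _ _ = ℕ.<-irrefl (sym e) (<-positional K n X t<s n<K)
  ... | tri≈ _ t≡s _ = t≢s t≡s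
  ... | tri> _ _ s<t = ℕ.<-irrefl e (begin-strict
    s * K + X        <⟨ ℕ.+-monoʳ-< (s * K) X<2K ⟩
    s * K + (K + K)  ≡⟨ two-more s K ⟩
    suc (suc s) * K  ≤⟨ ℕ.*-monoˡ-≤ K (ℕ.≤∧≢⇒< s<t (t≢1+s ∘ sym)) ⟩
    t * K            ≤⟨ ℕ.m≤m+n (t * K) n ⟩
    t * K + n        ∎)
    where
    open ℕ.≤-Reasoning
    two-more : ∀ s K → s * K + (K + K) ≡ suc (suc s) * K
    two-more = solve-∀

module Numerals (k : ℕ) where

  value-∷ : ∀ d w → value k (d ∷ w) ≡ toℕ d * k ^ length w + value k w
  value-∷ d w = foldl-digits (toℕ d) w
    where
    foldl-digits : ∀ acc w → foldl (λ acc d → acc * k + toℕ d) acc w ≡ acc * k ^ length w + value k w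
    foldl-digits acc []      = sym (trans (ℕ.+-identityʳ (acc * 1)) (ℕ.*-identityʳ acc))
    foldl-digits acc (d ∷ w) = begin
      foldl _ (acc * k + toℕ d) w              ≡⟨ foldl-digits (acc * k + toℕ d) w ⟩
      (acc * k + toℕ d) * K + value k w        ≡⟨ regroup acc k (toℕ d) K (value k w) ⟩
      acc * (k * K) + (toℕ d * K + value k w)  ≡⟨ cong (acc * (k * K) +_) (foldl-digits (toℕ d) w) ⟨
      acc * (k * K) + value k (d ∷ w)          ∎
      where
      open ≡-Reasoning
      K : ℕ
      K = k ^ length w
      regroup : ∀ a b c K V → (a * b + c) * K + V ≡ a * (b * K) + (c * K + V)
      regroup = solve-∀

  value-< : ∀ w → value k w < k ^ length w
  value-< []      = s≤s z≤n
  value-< (d ∷ w) = begin-strict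
    value k (d ∷ w)                   ≡⟨ value-∷ d w ⟩
    toℕ d * k ^ length w + value k w  <⟨ <-positional _ (value k w) 0 (toℕ<n d) (value-< w) ⟩
    k * k ^ length w + 0              ≡⟨ ℕ.+-identityʳ (k ^ suc (length w)) ⟩
    k ^ suc (length w)                ∎
    where open ℕ.≤-Reasoning

  value-<′ : ∀ {m} w → length w ≡ m → value k w < k ^ m
  value-<′ w refl = value-< w

  value-∷′ : ∀ {m} d w → length w ≡ m → value k (d ∷ w) ≡ toℕ d * k ^ m + value k w
  value-∷′ d w refl = value-∷ d w

  sumWords : ℕ → (Word k → ℕ) → ℕ
  sumWords zero    f = f []
  sumWords (suc m) f = ∑[ d < k ] sumWords m (λ u → f (d ∷ u))

  sumWords-cong : ∀ m {f g : Word k → ℕ} → (∀ u → length u ≡ m → f u ≡ g u) →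
    sumWords m f ≡ sumWords m g
  sumWords-cong zero    f≗g = f≗g [] refl
  sumWords-cong (suc m) f≗g =
    sum-cong-≗ (λ d → sumWords-cong m (λ u ∣u∣≡m → f≗g (d ∷ u) (cong suc ∣u∣≡m)))

  sumWords-zero : ∀ m → sumWords m (λ _ → 0) ≡ 0
  sumWords-zero zero    = refl
  sumWords-zero (suc m) = sum-zero {k} (λ _ → sumWords m (λ _ → 0)) (λ _ → sumWords-zero m)

  sumWords-∑ : ∀ m {n} (f : Word k → Fin n → ℕ) →
    sumWords m (λ u → ∑[ j < n ] f u j) ≡ ∑[ j < n ] sumWords m (λ u → f u j)
  sumWords-∑ zero    f = refl
  sumWords-∑ (suc m) f = trans (sum-cong-≗ (λ d → sumWords-∑ m (λ u → f (d ∷ u))))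
                               (∑-comm (λ d j → sumWords m (λ u → f (d ∷ u) j)))

  sumWords-value : ∀ m (f : ℕ → ℕ) → sumWords m (λ u → f (value k u)) ≡ sumℕ (k ^ m) f
  sumWords-value zero    f = refl
  sumWords-value (suc m) f = trans (sum-cong-≗ block) (sumℕ-* k (k ^ m) f)
    where
    block : ∀ d →
      sumWords m (λ u → f (value k (d ∷ u))) ≡ sumℕ (k ^ m) (λ x → f (toℕ d * k ^ m + x))
    block d = trans (sumWords-cong m (λ u ∣u∣≡m → cong f (value-∷′ d u ∣u∣≡m)))
                    (sumWords-value m (λ x → f (toℕ d * k ^ m + x)))

  sumWordPairs : ℕ → (Word k → Word k → ℕ) → ℕ
  sumWordPairs m f = sumWords m (λ u → sumWords m (f u))

  sumWordPairs-cong : ∀ m {f g : Word k → Word k → ℕ} →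
    (∀ u v → length u ≡ m → length v ≡ m → f u v ≡ g u v) → sumWordPairs m f ≡ sumWordPairs m g
  sumWordPairs-cong m f≗g =
    sumWords-cong m (λ u ∣u∣≡m → sumWords-cong m (λ v → f≗g u v ∣u∣≡m))

  sumWordPairs-value : ∀ m (g : ℕ → ℕ → ℕ) →
    sumWordPairs m (λ u v → g (value k u) (value k v)) ≡ sumℕ (k ^ m) (λ x → sumℕ (k ^ m) (g x))
  sumWordPairs-value m g = trans (sumWords-cong m (λ u _ → sumWords-value m (g (value k u))))
                                 (sumWords-value m (λ x → sumℕ (k ^ m) (g x)))

  compareWords : Comparison → Word k → Word k → Comparison
  compareWords o (x ∷ u) (y ∷ v) = compareWords (lex o (cmp (toℕ x) (toℕ y))) u v
  compareWords o _       _       = o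

  compareWords-value : ∀ o u v → length u ≡ length v →
    compareWords o u v ≡ lex o (cmp (value k u) (value k v))
  compareWords-value o []      []      _       = sym (lex-equalʳ o)
  compareWords-value o (x ∷ u) (y ∷ v) ∣xu∣≡∣yv∣ = begin
    compareWords (lex o (cmp (toℕ x) (toℕ y))) u v
      ≡⟨ compareWords-value _ u v ∣u∣≡∣v∣ ⟩
    lex (lex o (cmp (toℕ x) (toℕ y))) (cmp (value k u) (value k v))
      ≡⟨ lex-assoc o _ _ ⟩
    lex o (lex (cmp (toℕ x) (toℕ y)) (cmp (value k u) (value k v)))
      ≡⟨ cong (lex o) leading ⟨
    lex o (cmp (value k (x ∷ u)) (value k (y ∷ v)))
      ∎
    where
    open ≡-Reasoning
    ∣u∣≡∣v∣ : length u ≡ length v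
    ∣u∣≡∣v∣ = ℕ.suc-injective ∣xu∣≡∣yv∣
    leading : cmp (value k (x ∷ u)) (value k (y ∷ v))
            ≡ lex (cmp (toℕ x) (toℕ y)) (cmp (value k u) (value k v))
    leading rewrite value-∷′ x u ∣u∣≡∣v∣ | value-∷ y v =
      cmp-positional (k ^ length v) (toℕ x) (toℕ y) (value-<′ u ∣u∣≡∣v∣) (value-< v)

  ≡ᵇ-digits : ∀ c d x y {w u v} → length u ≡ length w → length v ≡ length w →
    (value k (x ∷ u) + value k (y ∷ v) ≡ᵇ value k (d ∷ w) + ind c * k ^ suc (length w))
      ≡ maybe′ (λ c′ → value k u + value k v ≡ᵇ value k w + ind c′ * k ^ length w) false
               (carryIn (toℕ x + toℕ y) (toℕ d + ind c * k))
  ≡ᵇ-digits c d x y {w} {u} {v} ∣u∣≡∣w∣ ∣v∣≡∣w∣ = begin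
    (value k (x ∷ u) + value k (y ∷ v) ≡ᵇ value k (d ∷ w) + ind c * (k * K))
      ≡⟨ cong₂ _≡ᵇ_ summands total ⟩
    ((toℕ x + toℕ y) * K + (value k u + value k v) ≡ᵇ (toℕ d + ind c * k) * K + value k w)
      ≡⟨ ≡ᵇ-positional K (toℕ x + toℕ y) (toℕ d + ind c * k) U+V<2K (value-< w) ⟩
    maybe′ (λ c′ → value k u + value k v ≡ᵇ value k w + ind c′ * K) false
           (carryIn (toℕ x + toℕ y) (toℕ d + ind c * k))
      ∎
    where
    open ≡-Reasoning
    K : ℕ
    K = k ^ length w
    U+V<2K : value k u + value k v < K + K
    U+V<2K = ℕ.+-mono-< (value-<′ u ∣u∣≡∣w∣) (value-<′ v ∣v∣≡∣w∣)
    summands : value k (x ∷ u) + value k (y ∷ v) ≡ (toℕ x + toℕ y) * K + (value k u + value k v)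
    summands = trans (cong₂ _+_ (value-∷′ x u ∣u∣≡∣w∣) (value-∷′ y v ∣v∣≡∣w∣))
                     (interchange (toℕ x) (toℕ y) (value k u) (value k v) K)
      where
      interchange : ∀ a b U V K → (a * K + U) + (b * K + V) ≡ (a + b) * K + (U + V)
      interchange = solve-∀
    total : value k (d ∷ w) + ind c * (k * K) ≡ (toℕ d + ind c * k) * K + value k w
    total = trans (cong (_+ ind c * (k * K)) (value-∷ d w)) (carry (toℕ d) (ind c) k K (value k w))
      where
      carry : ∀ a c k K W → (a * K + W) + c * (k * K) ≡ (a + c * k) * K + W
      carry = solve-∀

module Padding {k : ℕ} (M : DFAO k) where
  open DFAO M

  skipZeros : Fin (suc nStates) → Fin k → Fin (suc nStates)
  skipZeros zero    zero    = zero
  skipZeros zero    (suc d) = suc (δ start (suc d))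
  skipZeros (suc q) d       = suc (δ q d)

  emit : Fin (suc nStates) → Bool
  emit zero    = τ start
  emit (suc q) = τ q

  padded : DFAO k
  padded = record { nStates = suc nStates ; start = zero ; δ = skipZeros ; τ = emit }

  run-suc : ∀ q w → run padded (suc q) w ≡ suc (run M q w)
  run-suc q []      = refl
  run-suc q (d ∷ w) = run-suc (δ q d) w

  padded-computes : ∀ {a} → Computes M a → ∀ w → a (value k w) ≡ emit (run padded zero w)
  padded-computes     M-computes-a []          = M-computes-a [] tt
  padded-computes {a} M-computes-a (zero ∷ w)  = padded-computes {a} M-computes-a w
  padded-computes     M-computes-a (suc d ∷ w) =
    trans (M-computes-a (suc d ∷ w) (λ ())) (cong emit (sym (run-suc (δ start (suc d)) w)))

ind-∧∧false : ∀ a b c → ind (a ∧ b ∧ false ∧ c) ≡ 0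
ind-∧∧false a b c = cong ind (trans (cong (a ∧_) (∧-zeroʳ b)) (∧-zeroʳ a))

pairCount : (ℕ → Bool) → (ℕ → ℕ → Bool) → ℕ → ℕ
pairCount a P n =
  sumℕ (suc n) λ x → sumℕ (suc n) λ y → ind (a x ∧ a y ∧ (x + y ≡ᵇ n) ∧ P x y)

module PairAutomaton {k : ℕ} (M : DFAO k) (select : Comparison → Bool) where
  open Numerals k
  open Padding M using (padded; padded-computes)
  open DFAO padded using (nStates; δ; τ)

  State : Set
  State = Fin nStates × Fin nStates × Bool × Comparison

  states : Fin (nStates * (nStates * (2 * 3))) ↔ State
  states = ↔-trans *↔× (↔-refl ×-↔ ↔-trans *↔×
             (↔-refl ×-↔ ↔-trans *↔× (2↔Bool ×-↔ 3↔Comparison)))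

  next : State → Fin k → Fin k → Bool → State
  next (p , q , _ , o) x y c′ = δ p x , δ q y , c′ , lex o (cmp (toℕ x) (toℕ y))

  step : State → Fin k → Fin k → Fin k → Maybe State
  step s@(_ , _ , c , _) d x y = Maybe.map (next s x y) (carryIn (toℕ x + toℕ y) (toℕ d + ind c * k))

  accept : State → ℕ
  accept (p , q , c , o) = ind (τ p ∧ τ q ∧ not c ∧ select o)

  open FiniteAutomaton states step accept using (count; countRep; evalRep-countRep)

  valid : State → Word k → Word k → Word k → Bool
  valid (p , q , c , o) w u v = τ (run padded p u) ∧ τ (run padded q v)
    ∧ (value k u + value k v ≡ᵇ value k w + ind c * k ^ length w) ∧ select (compareWords o u v)

  valid-[] : ∀ s → ind (valid s [] [] []) ≡ accept s
  valid-[] (p , q , false , o) = refl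
  valid-[] (p , q , true  , o) = refl

  valid-∷ : ∀ s d x y {w u v} → length u ≡ length w → length v ≡ length w →
    ind (valid s (d ∷ w) (x ∷ u) (y ∷ v)) ≡ maybe′ (λ s′ → ind (valid s′ w u v)) 0 (step s d x y)
  valid-∷ s@(p , q , c , o) d x y {w} {u} {v} ∣u∣≡∣w∣ ∣v∣≡∣w∣ =
    trans (cong (λ b → ind (A ∧ B ∧ b ∧ C))
                (≡ᵇ-digits c d x y {w} {u} {v} ∣u∣≡∣w∣ ∣v∣≡∣w∣))
          (by-carry (carryIn (toℕ x + toℕ y) (toℕ d + ind c * k)))
    where
    A B C : Bool
    A = τ (run padded (δ p x) u)
    B = τ (run padded (δ q y) v)
    C = select (compareWords (lex o (cmp (toℕ x) (toℕ y))) u v)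
    E : Bool → Bool
    E c′ = value k u + value k v ≡ᵇ value k w + ind c′ * k ^ length w
    by-carry : ∀ mc → ind (A ∧ B ∧ maybe′ E false mc ∧ C)
                      ≡ maybe′ (λ s′ → ind (valid s′ w u v)) 0 (Maybe.map (next s x y) mc)
    by-carry nothing   = ind-∧∧false A B C
    by-carry (just c′) = refl

  count-valid : ∀ w s → count s w ≡ sumWordPairs (length w) (λ u v → ind (valid s w u v))
  count-valid []      s = sym (valid-[] s)
  count-valid (d ∷ w) s = begin
    ∑[ x < k ] ∑[ y < k ] maybe′ (λ s′ → count s′ w) 0 (step s d x y)
      ≡⟨ sum-cong-≗ (λ x → sum-cong-≗ (λ y → count-step (step s d x y))) ⟩
    ∑[ x < k ] ∑[ y < k ] sumWordPairs m (λ u v → ind-valid w u v (step s d x y))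
      ≡⟨ sum-cong-≗ (λ x → sum-cong-≗ (λ y → sumWordPairs-cong m (λ u v ∣u∣≡m ∣v∣≡m →
           valid-∷ s d x y {w} {u} {v} ∣u∣≡m ∣v∣≡m))) ⟨
    ∑[ x < k ] ∑[ y < k ] sumWordPairs m (valid∷ x y)
      ≡⟨ sum-cong-≗ (λ x → sumWords-∑ m (λ u y → sumWords m (valid∷ x y u))) ⟨
    ∑[ x < k ] sumWords m (λ u → ∑[ y < k ] sumWords m (valid∷ x y u))
      ∎
    where
    open ≡-Reasoning
    m : ℕ
    m = length w
    valid∷ : Fin k → Fin k → Word k → Word k → ℕ
    valid∷ x y u v = ind (valid s (d ∷ w) (x ∷ u) (y ∷ v))
    ind-valid : Word k → Word k → Word k → Maybe State → ℕ
    ind-valid w u v = maybe′ (λ s′ → ind (valid s′ w u v)) 0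
    count-step : ∀ ms → maybe′ (λ s′ → count s′ w) 0 ms ≡ sumWordPairs m (λ u v → ind-valid w u v ms)
    count-step nothing   = sym (trans (sumWords-cong m (λ _ _ → sumWords-zero m)) (sumWords-zero m))
    count-step (just s′) = count-valid w s′

  initial : State
  initial = zero , zero , false , equal

  count-initial : ∀ {a} → Computes M a → ∀ w →
    count initial w ≡ pairCount a (λ x y → select (cmp x y)) (value k w)
  count-initial {a} M-computes-a w = begin
    count initial w                                     ≡⟨ count-valid w initial ⟩
    sumWordPairs m (λ u v → ind (valid initial w u v))  ≡⟨ sumWordPairs-cong m valid-initial ⟩
    sumWordPairs m (λ u v → g (value k u) (value k v))  ≡⟨ sumWordPairs-value m g ⟩
    sumℕ (k ^ m) (λ x → sumℕ (k ^ m) (g x))             ≡⟨ sumℕ²-truncate g (value-< w) g≗0 ⟩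
    pairCount a (λ x y → select (cmp x y)) n            ∎
    where
    open ≡-Reasoning
    m n : ℕ
    m = length w
    n = value k w
    g : ℕ → ℕ → ℕ
    g x y = ind (a x ∧ a y ∧ (x + y ≡ᵇ n) ∧ select (cmp x y))
    valid-initial : ∀ u v → length u ≡ m → length v ≡ m →
      ind (valid initial w u v) ≡ g (value k u) (value k v)
    valid-initial u v ∣u∣≡m ∣v∣≡m
      rewrite sym (padded-computes {a} M-computes-a u) | sym (padded-computes {a} M-computes-a v)
            | ℕ.+-identityʳ n | compareWords-value equal u v (trans ∣u∣≡m (sym ∣v∣≡m)) = refl
    g≗0 : ∀ x y → n < x + y → g x y ≡ 0
    g≗0 x y n<x+y = trans (cong (λ b → ind (a x ∧ a y ∧ b ∧ select (cmp x y)))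
                                (dec-false (x + y ℕ.≟ n) (λ x+y≡n → ℕ.<-irrefl (sym x+y≡n) n<x+y)))
                          (ind-∧∧false (a x) (a y) (select (cmp x y)))

  pairRep : LinRep k
  pairRep = countRep initial

  pairRep-represents : ∀ a {f} → Computes M a →
    (∀ n → pairCount a (λ x y → select (cmp x y)) n ≡ f n) → Represents pairRep f
  pairRep-represents a {f} M-computes-a count≗f w = sym (begin
    evalRep pairRep w
      ≡⟨ evalRep-countRep initial w ⟩
    toℚ (count initial w)
      ≡⟨ cong toℚ (count-initial {a} M-computes-a w) ⟩
    toℚ (pairCount a (λ x y → select (cmp x y)) (value k w))
      ≡⟨ cong toℚ (count≗f (value k w)) ⟩
    toℚ (f (value k w))
      ∎)
    where open ≡-Reasoning

pairCount-cong : ∀ a {P Q : ℕ → ℕ → Bool} → (∀ x y → P x y ≡ Q x y) →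
  ∀ n → pairCount a P n ≡ pairCount a Q n
pairCount-cong a P≗Q n = sumℕ-cong (suc n) (λ x → sumℕ-cong (suc n) (λ y →
  cong (λ b → ind (a x ∧ a y ∧ (x + y ≡ᵇ n) ∧ b)) (P≗Q x y)))

pairCount-true : ∀ a n → pairCount a (λ _ _ → true) n ≡ R₁ a n
pairCount-true a n = sumℕ-cong (suc n) (λ x → sumℕ-cong (suc n) (λ y →
  cong (λ b → ind (a x ∧ a y ∧ b)) (∧-identityʳ (x + y ≡ᵇ n))))

-- The construction works for every base k.
theorem3 : (k : ℕ) → 2 ≤ k → (M : DFAO k) →
    Σ[ ρ₁ ∈ LinRep k ] Σ[ ρ₂ ∈ LinRep k ] Σ[ ρ₃ ∈ LinRep k ]
      ((a : ℕ → Bool) → Computes M a →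
        Represents ρ₁ (R₁ a) × Represents ρ₂ (R₂ a) × Represents ρ₃ (R₃ a))
theorem3 k _ M =
  pairRep (λ _ → true) , pairRep isLess , pairRep isAtMost , λ a M-computes-a →
    pairRep-represents (λ _ → true) a M-computes-a (pairCount-true a) ,
    pairRep-represents isLess a M-computes-a (pairCount-cong a isLess-cmp) ,
    pairRep-represents isAtMost a M-computes-a (pairCount-cong a isAtMost-cmp)
  where open PairAutomaton M using (pairRep; pairRep-represents)
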